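{- Let $\ell,t$ be positive integers. Let $G$ be a graph such that for every set $S$ of $2t+2\ell$ vertices of $G$ there is a set $X$ of at most $\ell$ vertices of $G$ such that each component of $G-X$ has at most $t$ vertices in $S$. Then $G$ has a slick tree-decomposition of width at most $2t+3\ell-1$ and degree at most $4+\lceil\frac{4\ell}{t}\rceil$.
   Context: Graphs are simple, undirected and finite. A tree-decomposition of $G$ is a collection $(B_x:x\in V(T))$, $T$ a non-empty tree, of subsets of $V(G)$ such that each edge of $G$ has both ends in some $B_x$ and for each $v\in V(G)$ the set $\{x:v\in B_x\}$ induces a non-empty connected subtree of $T$; its width is $\max_x|B_x|-1$ and its degree is the maximum degree of $T$. It is rooted if $T$ is rooted. A rooted tree-decomposition is slick if for each edge $xy\in E(T)$ with $x$ the parent of $y$, and each vertex $v\in B_x\cap B_y$, we have $(N_G(v)\cap B_y)\setminus B_x\neq\emptyset$. -}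

module Defs where

open import Data.Nat using (ℕ; zero; suc; _+_; _*_; _∸_; _≤_; NonZero)
open import Data.Nat.DivMod using (_/_)
open import Data.Fin using (Fin; toℕ; _<_) renaming (zero to fzero; suc to fsuc)
open import Data.Fin.Properties using () renaming (_≟_ to _≟ᶠ_)
open import Data.Fin.Subset using (Subset; _∈_; _∉_; _⊆_; ∣_∣)
open import Data.Bool using (Bool; true; false; T)
open import Data.List using (length; filter; allFin)
open import Data.Product using (Σ; ∃; _×_; _,_)
open import Relation.Binary.PropositionalEquality using (_≡_; _≢_)
open import Relation.Nullary using (¬_)

⌈_/_⌉ : ℕ → (b : ℕ) → .{{NonZero b}} → ℕ
⌈ a / b ⌉ = (a + b ∸ 1) / b

record Graph (n : ℕ) : Set where
  field
    adj   : Fin n → Fin n → Bool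
    sym   : ∀ u v → adj u v ≡ adj v u
    irrefl : ∀ v → adj v v ≡ false
open Graph public

Adj : ∀ {n} → Graph n → Fin n → Fin n → Set
Adj G u v = T (adj G u v)

data Walk {A : Set} (R : A → A → Set) (P : A → Set) : A → A → Set where
  here : ∀ {u} → P u → Walk R P u u
  step : ∀ {u w v} → P u → R u w → Walk R P w v → Walk R P u v

ConnectedIn- : ∀ {n} → Graph n → Subset n → Fin n → Fin n → Set
ConnectedIn- G X u v = Walk (Adj G) (λ w → w ∉ X) u v

ComponentsMeetAtMost : ∀ {n} → Graph n → Subset n → Subset n → ℕ → Set
ComponentsMeetAtMost {n} G X S t =
  ∀ v → v ∉ X → ∀ (C : Subset n) → C ⊆ S → (∀ u → u ∈ C → ConnectedIn- G X v u) → ∣ C ∣ ≤ t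

-- A rooted tree on node set Fin (suc m): node fzero is the root and node (fsuc i)
-- has parent (parent i), with parent i < fsuc i (every finite rooted tree has such a labelling).
record RootedTree (m : ℕ) : Set where
  field
    parent    : Fin m → Fin (suc m)
    parent-lt : ∀ i → parent i < fsuc i
open RootedTree public

data TreeAdj {m} (T' : RootedTree m) : Fin (suc m) → Fin (suc m) → Set where
  up   : ∀ i → TreeAdj T' (fsuc i) (parent T' i)
  down : ∀ i → TreeAdj T' (parent T' i) (fsuc i)

numChildren : ∀ {m} → RootedTree m → Fin (suc m) → ℕ
numChildren {m} T' x = length (filter (λ i → parent T' i ≟ᶠ x) (allFin m))

degree : ∀ {m} → RootedTree m → Fin (suc m) → ℕ
degree T' fzero     = numChildren T' fzero
degree T' (fsuc x)  = suc (numChildren T' (fsuc x))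

record RootedTreeDecomposition {n} (G : Graph n) : Set where
  field
    m     : ℕ
    tree  : RootedTree m
    bag   : Fin (suc m) → Subset n
    edge-covered : ∀ u v → Adj G u v → ∃ λ x → u ∈ bag x × v ∈ bag x
    vertex-nonempty : ∀ v → ∃ λ x → v ∈ bag x
    vertex-connected : ∀ v x y → v ∈ bag x → v ∈ bag y →
      Walk (TreeAdj tree) (λ z → v ∈ bag z) x y
open RootedTreeDecomposition public

WidthAtMost : ∀ {n} {G : Graph n} → RootedTreeDecomposition G → ℕ → Set
WidthAtMost D w = ∀ x → ∣ bag D x ∣ ≤ suc w

DegreeAtMost : ∀ {n} {G : Graph n} → RootedTreeDecomposition G → ℕ → Set
DegreeAtMost D d = ∀ x → degree (tree D) x ≤ d

Slick : ∀ {n} {G : Graph n} → RootedTreeDecomposition G → Set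
Slick {G = G} D = ∀ i v → v ∈ bag D (parent (tree D) i) → v ∈ bag D (fsuc i) →
  ∃ λ u → Adj G v u × u ∈ bag D (fsuc i) × u ∉ bag D (parent (tree D) i)

-- The decomposition is built top-down. A recursive call receives a set A of vertices still to be
-- decomposed and an interface W ⊆ A shared with the parent bag, with ∣W∣ ≤ t + ℓ and every vertex
-- of W adjacent to A ∖ W. If ∣A∣ ≤ 2t + 3ℓ a single bag A suffices. Otherwise choose for every
-- w ∈ W a neighbour in A ∖ W, extend W and these neighbours to a set S ⊆ A of exactly 2t + 2ℓ
-- vertices, take the separator X for S and make R = S ∪ (X ∩ A) the root bag; the chosen
-- neighbours make the edge to the parent slick. The components of G - X inside A ∖ R are merged
-- greedily into groups, each of which reaches at most t + ℓ - ∣X ∩ A∣ vertices of S while any two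
-- together reach more. Groups reach disjoint parts of S, so there are at most 3 + ⌈4ℓ/t⌉ of them:
-- pairwise sums exceeding t with total at most 2t + 2ℓ force L (t + 1) ≤ 2 (2t + 2ℓ) for L ≥ 2
-- groups. Each group, together with its at most t + ℓ neighbours in R as new interface, is
-- decomposed recursively below the root; ∣A ∖ W∣ drops because S ∖ W is nonempty and lies in no
-- child.

module Submission where

open import Defs hiding (sym)
open import Level using (0ℓ)
open import Data.Nat as ℕ using (ℕ; zero; suc; pred; _+_; _*_; _∸_; _≤_; _<_; z≤n; s≤s; NonZero; _≤?_)
open import Data.Nat.Properties hiding (_≟_)
open import Data.Nat.DivMod using (_/_; _%_; m≡m%n+[m/n]*n; m%n<n)
open import Data.Nat.ListAction using (sum)
open import Data.Nat.Tactic.RingSolver using (solve-∀)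
open import Data.Bool using (Bool; true; false; T; T?; if_then_else_)
open import Data.Fin using (Fin; zero; suc; toℕ; _↑ˡ_; _↑ʳ_; splitAt)
open import Data.Fin.Properties using (_≟_; any?; toℕ-↑ˡ; toℕ-↑ʳ; ↑ˡ-injective; ↑ʳ-injective;
  splitAt-↑ˡ; splitAt-↑ʳ; splitAt⁻¹-↑ˡ; splitAt⁻¹-↑ʳ)
open import Data.Fin.Subset
open import Data.Fin.Subset.Properties
open import Data.Vec using (_∷_; []; here; there)
import Data.Vec as Vec
open import Data.Vec.Properties using (lookup∘tabulate; []=⇒lookup; lookup⇒[]=)
open import Data.List using (List; []; _∷_; length; map; foldr; filter; tabulate; allFin)
open import Data.List.Properties using (length-map)
open import Data.List.Membership.Propositional using () renaming (_∈_ to _∈ₗ_)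
open import Data.List.Membership.Propositional.Properties using (∈-allFin)
open import Data.List.Relation.Unary.Any using (here; there)
open import Data.List.Relation.Unary.All as All using (All; []; _∷_)
import Data.List.Relation.Unary.All.Properties as All
open import Data.List.Relation.Unary.AllPairs as AllPairs using (AllPairs; []; _∷_)
import Data.List.Relation.Unary.AllPairs.Properties as AllPairs
open import Data.Product using (Σ; ∃; _×_; _,_; proj₁; proj₂)
open import Data.Sum using (inj₁; inj₂; [_,_]′)
open import Function using (_∘_; id; mk⇔)
open import Relation.Nullary using (¬_; Dec; yes; no; does; contradiction)
open import Relation.Nullary.Decidable using (_×-dec_; ¬?; decidable-stable; dec-true; dec-false; does-⇔)
open import Relation.Unary using (Pred; Decidable)
open import Relation.Binary using (Rel)
open import Relation.Binary.PropositionalEquality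

private variable
  n : ℕ
  x : Fin n
  p q r : Subset n

-- Finite sets

subset : {P : Pred (Fin n) 0ℓ} → Decidable P → Subset n
subset P? = Vec.tabulate (λ x → does (P? x))

∈-subset⁺ : {P : Pred (Fin n) 0ℓ} (P? : Decidable P) {x : Fin n} → P x → x ∈ subset P?
∈-subset⁺ P? {x} px = lookup⇒[]= x _ (trans (lookup∘tabulate _ x) (dec-true (P? x) px))

∈-subset⁻ : {P : Pred (Fin n) 0ℓ} (P? : Decidable P) {x : Fin n} → x ∈ subset P? → P x
∈-subset⁻ P? {x} x∈ with P? x | trans (sym (lookup∘tabulate _ x)) ([]=⇒lookup x∈)
... | yes px | _ = px
... | no _   | ()

x∈p⇒⁅x⁆⊆p : x ∈ p → ⁅ x ⁆ ⊆ p
x∈p⇒⁅x⁆⊆p {x = x} {p = p} x∈p y∈⁅x⁆ = subst (_∈ p) (sym (x∈⁅y⁆⇒x≡y x y∈⁅x⁆)) x∈p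

∪-least : p ⊆ r → q ⊆ r → p ∪ q ⊆ r
∪-least {p = p} {q = q} p⊆r q⊆r x∈ = [ p⊆r , q⊆r ]′ (x∈p∪q⁻ p q x∈)

∪-monoʳ-⊆ : ∀ r → p ⊆ q → r ∪ p ⊆ r ∪ q
∪-monoʳ-⊆ {q = q} r p⊆q = ∪-least (p⊆p∪q q) (q⊆p∪q r q ∘ p⊆q)

x∈p─q⁻ : ∀ {n} {x : Fin n} (p q : Subset n) → x ∈ p ─ q → x ∈ p × x ∉ q
x∈p─q⁻ {x = zero}  (true ∷ p)  (false ∷ q) here = here , λ ()
x∈p─q⁻ {x = suc x} (_ ∷ p)     (_ ∷ q)     (there x∈) with x∈p─q⁻ p q x∈
... | x∈p , x∉q = there x∈p , λ { (there x∈q) → x∉q x∈q }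

∣p∪q∣+∣p∩q∣≡∣p∣+∣q∣ : ∀ (p q : Subset n) → ∣ p ∪ q ∣ + ∣ p ∩ q ∣ ≡ ∣ p ∣ + ∣ q ∣
∣p∪q∣+∣p∩q∣≡∣p∣+∣q∣ [] [] = refl
∣p∪q∣+∣p∩q∣≡∣p∣+∣q∣ (true ∷ p) (true ∷ q) = cong suc (begin
  ∣ p ∪ q ∣ + suc ∣ p ∩ q ∣ ≡⟨ +-suc _ _ ⟩
  suc (∣ p ∪ q ∣ + ∣ p ∩ q ∣) ≡⟨ cong suc (∣p∪q∣+∣p∩q∣≡∣p∣+∣q∣ p q) ⟩
  suc (∣ p ∣ + ∣ q ∣) ≡⟨ +-suc _ _ ⟨
  ∣ p ∣ + suc ∣ q ∣ ∎)
  where open ≡-Reasoning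
∣p∪q∣+∣p∩q∣≡∣p∣+∣q∣ (true ∷ p) (false ∷ q) = cong suc (∣p∪q∣+∣p∩q∣≡∣p∣+∣q∣ p q)
∣p∪q∣+∣p∩q∣≡∣p∣+∣q∣ (false ∷ p) (true ∷ q) =
  trans (cong suc (∣p∪q∣+∣p∩q∣≡∣p∣+∣q∣ p q)) (sym (+-suc ∣ p ∣ ∣ q ∣))
∣p∪q∣+∣p∩q∣≡∣p∣+∣q∣ (false ∷ p) (false ∷ q) = ∣p∪q∣+∣p∩q∣≡∣p∣+∣q∣ p q

∣p∪q∣≤∣p∣+∣q∣ : ∀ (p q : Subset n) → ∣ p ∪ q ∣ ≤ ∣ p ∣ + ∣ q ∣
∣p∪q∣≤∣p∣+∣q∣ p q = ≤-trans (m≤m+n _ _) (≤-reflexive (∣p∪q∣+∣p∩q∣≡∣p∣+∣q∣ p q))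

Disjoint : Subset n → Subset n → Set
Disjoint p q = ∀ {x} → x ∈ p → x ∉ q

Disjoint-sym : Disjoint p q → Disjoint q p
Disjoint-sym p#q x∈q x∈p = p#q x∈p x∈q

∪-left-comm : ∀ (p q r : Subset n) → p ∪ (q ∪ r) ≡ q ∪ (p ∪ r)
∪-left-comm p q r = begin
  p ∪ (q ∪ r)  ≡⟨ ∪-assoc p q r ⟨
  (p ∪ q) ∪ r  ≡⟨ cong (_∪ r) (∪-comm p q) ⟩
  (q ∪ p) ∪ r  ≡⟨ ∪-assoc q p r ⟩
  q ∪ (p ∪ r)  ∎
  where open ≡-Reasoning

Disjoint-∪ˡ : ∀ {p q r : Subset n} → Disjoint p r → Disjoint q r → Disjoint (p ∪ q) r
Disjoint-∪ˡ {p = p} {q} p#r q#r x∈p∪q = [ p#r , q#r ]′ (x∈p∪q⁻ p q x∈p∪q)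

Disjoint⇒∣p∪q∣≡∣p∣+∣q∣ : ∀ (p q : Subset n) → Disjoint p q → ∣ p ∪ q ∣ ≡ ∣ p ∣ + ∣ q ∣
Disjoint⇒∣p∪q∣≡∣p∣+∣q∣ {n} p q p#q = begin
  ∣ p ∪ q ∣                 ≡⟨ +-identityʳ _ ⟨
  ∣ p ∪ q ∣ + 0             ≡⟨ cong (∣ p ∪ q ∣ +_) (∣⊥∣≡0 n) ⟨
  ∣ p ∪ q ∣ + ∣ ⊥ {n} ∣      ≡⟨ cong (λ r → ∣ p ∪ q ∣ + ∣ r ∣) p∩q≡⊥ ⟨
  ∣ p ∪ q ∣ + ∣ p ∩ q ∣     ≡⟨ ∣p∪q∣+∣p∩q∣≡∣p∣+∣q∣ p q ⟩
  ∣ p ∣ + ∣ q ∣             ∎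
  where
  open ≡-Reasoning
  p∩q≡⊥ : p ∩ q ≡ ⊥
  p∩q≡⊥ = Empty-unique λ (_ , x∈p∩q) → let x∈p , x∈q = x∈p∩q⁻ p q x∈p∩q in p#q x∈p x∈q

∣p∪⁅x⁆∣≡1+∣p∣ : ∀ (p : Subset n) → x ∉ p → ∣ p ∪ ⁅ x ⁆ ∣ ≡ suc ∣ p ∣
∣p∪⁅x⁆∣≡1+∣p∣ {x = x} p x∉p = begin
  ∣ p ∪ ⁅ x ⁆ ∣      ≡⟨ Disjoint⇒∣p∪q∣≡∣p∣+∣q∣ p ⁅ x ⁆ p#x ⟩
  ∣ p ∣ + ∣ ⁅ x ⁆ ∣  ≡⟨ cong (∣ p ∣ +_) (∣⁅x⁆∣≡1 x) ⟩
  ∣ p ∣ + 1          ≡⟨ +-comm ∣ p ∣ 1 ⟩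
  suc ∣ p ∣          ∎
  where
  open ≡-Reasoning
  p#x : Disjoint p ⁅ x ⁆
  p#x y∈p y∈x = x∉p (subst (_∈ p) (x∈⁅y⁆⇒x≡y x y∈x) y∈p)

private
  ∃∈q∉p-there : ∀ {s t} → ∃ (λ x → x ∈ q × x ∉ p) → ∃ λ x → x ∈ s ∷ q × x ∉ t ∷ p
  ∃∈q∉p-there (x , x∈q , x∉p) = suc x , there x∈q , λ { (there x∈p) → x∉p x∈p }

∣p∣<∣q∣⇒∃∈q∉p : ∀ (p q : Subset n) → ∣ p ∣ < ∣ q ∣ → ∃ λ x → x ∈ q × x ∉ p
∣p∣<∣q∣⇒∃∈q∉p (false ∷ p) (true  ∷ q) _        = zero , here , λ ()
∣p∣<∣q∣⇒∃∈q∉p (true  ∷ p) (true  ∷ q) (s≤s lt) = ∃∈q∉p-there (∣p∣<∣q∣⇒∃∈q∉p p q lt)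
∣p∣<∣q∣⇒∃∈q∉p (true  ∷ p) (false ∷ q) lt       = ∃∈q∉p-there (∣p∣<∣q∣⇒∃∈q∉p p q (<-trans (n<1+n _) lt))
∣p∣<∣q∣⇒∃∈q∉p (false ∷ p) (false ∷ q) lt       = ∃∈q∉p-there (∣p∣<∣q∣⇒∃∈q∉p p q lt)

∃-between-of-size : ∀ {W A : Subset n} {s} → W ⊆ A → ∣ W ∣ ≤ s → s ≤ ∣ A ∣ →
  ∃ λ S → W ⊆ S × S ⊆ A × ∣ S ∣ ≡ s
∃-between-of-size {W = W} {A} {s} W⊆A ∣W∣≤s = grow (s ∸ ∣ W ∣) W⊆A (m+[n∸m]≡n ∣W∣≤s)
  where
  room : ∀ V {d} → ∣ V ∣ + suc d ≡ s → s ≤ ∣ A ∣ → ∣ V ∣ < ∣ A ∣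
  room V ∣V∣+1+d≡s s≤∣A∣ = ≤-trans (m<m+n ∣ V ∣ ℕ.z<s) (≤-trans (≤-reflexive ∣V∣+1+d≡s) s≤∣A∣)
  add-one : ∀ {V x d} → x ∉ V → ∣ V ∣ + suc d ≡ s → ∣ V ∪ ⁅ x ⁆ ∣ + d ≡ s
  add-one {V} {d = d} x∉V ∣V∣+1+d≡s =
    trans (cong (_+ d) (∣p∪⁅x⁆∣≡1+∣p∣ V x∉V)) (trans (sym (+-suc _ d)) ∣V∣+1+d≡s)
  grow : ∀ d {V} → V ⊆ A → ∣ V ∣ + d ≡ s → s ≤ ∣ A ∣ → ∃ λ S → V ⊆ S × S ⊆ A × ∣ S ∣ ≡ s
  grow zero    {V} V⊆A ∣V∣+0≡s _ = V , ⊆-refl , V⊆A , trans (sym (+-identityʳ _)) ∣V∣+0≡s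
  grow (suc d) {V} V⊆A ∣V∣+1+d≡s s≤∣A∣
    with x , x∈A , x∉V ← ∣p∣<∣q∣⇒∃∈q∉p V A (room V ∣V∣+1+d≡s s≤∣A∣)
    with S , V∪x⊆S , S⊆A , ∣S∣≡s ← grow d (∪-least V⊆A (x∈p⇒⁅x⁆⊆p x∈A)) (add-one x∉V ∣V∣+1+d≡s) s≤∣A∣
    = S , V∪x⊆S ∘ p⊆p∪q ⁅ x ⁆ , S⊆A , ∣S∣≡s

witness-set : ∀ {m} {A : Subset n} (Q : Fin m → Fin n → Set) (W : Subset m) →
  (∀ {w} → w ∈ W → ∃ λ u → u ∈ A × Q w u) →
  ∃ λ N → N ⊆ A × ∣ N ∣ ≤ ∣ W ∣ × (∀ {w} → w ∈ W → ∃ λ u → u ∈ N × Q w u)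
witness-set {n} Q [] _ = ⊥ , (λ x∈⊥ → contradiction x∈⊥ ∉⊥) , ≤-reflexive (∣⊥∣≡0 n) , λ ()
witness-set Q (false ∷ W) has-witness
  with N , N⊆A , ∣N∣≤∣W∣ , N-witness ← witness-set (Q ∘ suc) W (has-witness ∘ there)
  = N , N⊆A , ∣N∣≤∣W∣ , λ { (there w∈W) → N-witness w∈W }
witness-set Q (true ∷ W) has-witness
  with N , N⊆A , ∣N∣≤∣W∣ , N-witness ← witness-set (Q ∘ suc) W (has-witness ∘ there)
     | u , u∈A , Q0u ← has-witness here
  = N ∪ ⁅ u ⁆ , ∪-least N⊆A (x∈p⇒⁅x⁆⊆p u∈A) , size , witness
  where
  size : ∣ N ∪ ⁅ u ⁆ ∣ ≤ suc ∣ W ∣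
  size = begin
    ∣ N ∪ ⁅ u ⁆ ∣      ≤⟨ ∣p∪q∣≤∣p∣+∣q∣ N ⁅ u ⁆ ⟩
    ∣ N ∣ + ∣ ⁅ u ⁆ ∣  ≡⟨ cong (∣ N ∣ +_) (∣⁅x⁆∣≡1 u) ⟩
    ∣ N ∣ + 1          ≡⟨ +-comm ∣ N ∣ 1 ⟩
    suc ∣ N ∣          ≤⟨ s≤s ∣N∣≤∣W∣ ⟩
    suc ∣ W ∣          ∎
    where open ≤-Reasoning
  witness : ∀ {w} → w ∈ true ∷ W → ∃ λ v → v ∈ N ∪ ⁅ u ⁆ × Q w v
  witness here = u , q⊆p∪q N ⁅ u ⁆ (x∈⁅x⁆ u) , Q0u
  witness (there w∈W) with v , v∈N , Qwv ← N-witness w∈W = v , p⊆p∪q ⁅ u ⁆ v∈N , Qwv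

⋃-least : ∀ {ps : List (Subset n)} → All (_⊆ r) ps → ⋃ ps ⊆ r
⋃-least []                x∈⊥ = contradiction x∈⊥ ∉⊥
⋃-least {ps = p ∷ ps} (p⊆r ∷ ps⊆r) = ∪-least p⊆r (⋃-least ps⊆r)

Disjoint-⋃ : ∀ {qs : List (Subset n)} → All (Disjoint p) qs → Disjoint p (⋃ qs)
Disjoint-⋃ []                x∈p x∈⊥ = ∉⊥ x∈⊥
Disjoint-⋃ {qs = q ∷ qs} (p#q ∷ p#qs) x∈p x∈ =
  [ p#q x∈p , Disjoint-⋃ p#qs x∈p ]′ (x∈p∪q⁻ q (⋃ qs) x∈)

∣⋃∣≡sum : ∀ {ps : List (Subset n)} → AllPairs Disjoint ps → ∣ ⋃ ps ∣ ≡ sum (map ∣_∣ ps)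
∣⋃∣≡sum {n} []              = ∣⊥∣≡0 n
∣⋃∣≡sum {ps = p ∷ ps} (p#ps ∷ disj) =
  trans (Disjoint⇒∣p∪q∣≡∣p∣+∣q∣ p (⋃ ps) (Disjoint-⋃ p#ps)) (cong (∣ p ∣ +_) (∣⋃∣≡sum disj))

-- Walks and connectivity in G - X

module _ {A : Set} {R : Rel A 0ℓ} {P : Pred A 0ℓ} where

  walk-head : ∀ {u v} → Walk R P u v → P u
  walk-head (here pu)     = pu
  walk-head (step pu _ _) = pu

  walk-last : ∀ {u v} → Walk R P u v → P v
  walk-last (here pv)    = pv
  walk-last (step _ _ w) = walk-last w

  walk-++ : ∀ {u v w} → Walk R P u v → Walk R P v w → Walk R P u w
  walk-++ (here _)        w′ = w′
  walk-++ (step pu uRx w) w′ = step pu uRx (walk-++ w w′)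

  walk-snoc : ∀ {u v w} → Walk R P u v → R v w → P w → Walk R P u w
  walk-snoc w vRw pw = walk-++ w (step (walk-last w) vRw (here pw))

  walk-reverse : (∀ {u v} → R u v → R v u) → ∀ {u v} → Walk R P u v → Walk R P v u
  walk-reverse R-sym (here pu)        = here pu
  walk-reverse R-sym (step pu uRx w)  = walk-snoc (walk-reverse R-sym w) (R-sym uRx) pu

walk-map : ∀ {A B : Set} {R : Rel A 0ℓ} {P : Pred A 0ℓ} {R′ : Rel B 0ℓ} {P′ : Pred B 0ℓ}
  (f : A → B) → (∀ {a b} → R a b → R′ (f a) (f b)) → (∀ {a} → P a → P′ (f a)) →
  ∀ {a b} → Walk R P a b → Walk R′ P′ (f a) (f b)
walk-map f R⇒R′ P⇒P′ (here pa)        = here (P⇒P′ pa)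
walk-map f R⇒R′ P⇒P′ (step pa aRx w) = step (P⇒P′ pa) (R⇒R′ aRx) (walk-map f R⇒R′ P⇒P′ w)

module Reachability {n : ℕ} (G : Graph n) (X : Subset n) where

  Adj-sym : ∀ {u v} → Adj G u v → Adj G v u
  Adj-sym {u} {v} = subst T (Graph.sym G u v)

  Adj? : ∀ u v → Dec (Adj G u v)
  Adj? u v = T? (adj G u v)

  infix 4 _~_
  _~_ : Fin n → Fin n → Set
  _~_ = ConnectedIn- G X

  ~-sym : ∀ {u v} → u ~ v → v ~ u
  ~-sym = walk-reverse Adj-sym

  ~-trans : ∀ {u v w} → u ~ v → v ~ w → u ~ w
  ~-trans = walk-++

  Closed : Subset n → Set
  Closed R = ∀ {z w} → z ∈ R → w ∉ X → Adj G z w → w ∈ R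

  Closed-~ : ∀ {R} → Closed R → ∀ {u v} → u ∈ R → u ~ v → v ∈ R
  Closed-~ R-closed u∈R (here _)            = u∈R
  Closed-~ R-closed u∈R (step _ u-x x~v) = Closed-~ R-closed (R-closed u∈R (walk-head x~v) u-x) x~v

  Frontier : Subset n → Fin n → Set
  Frontier R w = w ∉ R × w ∉ X × ∃ λ z → z ∈ R × Adj G z w

  frontier? : ∀ R w → Dec (Frontier R w)
  frontier? R w = ¬? (w ∈? R) ×-dec ¬? (w ∈? X) ×-dec any? (λ z → z ∈? R ×-dec Adj? z w)

  grow : ℕ → Subset n → Subset n
  grow zero    R = R
  grow (suc f) R with any? (frontier? R)
  ... | yes (w , _) = grow f (R ∪ ⁅ w ⁆)
  ... | no _        = R

  grow-⊇ : ∀ f R → R ⊆ grow f R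
  grow-⊇ zero    R x∈R = x∈R
  grow-⊇ (suc f) R x∈R with any? (frontier? R)
  ... | yes (w , _) = grow-⊇ f (R ∪ ⁅ w ⁆) (p⊆p∪q ⁅ w ⁆ x∈R)
  ... | no _        = x∈R

  grow-closed : ∀ f R → n < ∣ R ∣ + f → Closed (grow f R)
  grow-closed zero    R n<∣R∣+0 = contradiction (subst (_ <_) (+-identityʳ _) n<∣R∣+0) (≤⇒≯ (∣p∣≤n R))
  grow-closed (suc f) R n<∣R∣+1+f with any? (frontier? R)
  ... | yes (w , w∉R , _) = grow-closed f (R ∪ ⁅ w ⁆) (subst (n <_) ∣R∣+1+f≡∣R∪w∣+f n<∣R∣+1+f)
    where
    ∣R∣+1+f≡∣R∪w∣+f : ∣ R ∣ + suc f ≡ ∣ R ∪ ⁅ w ⁆ ∣ + f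
    ∣R∣+1+f≡∣R∪w∣+f = trans (+-suc _ f) (cong (_+ f) (sym (∣p∪⁅x⁆∣≡1+∣p∣ R w∉R)))
  ... | no no-frontier = R-closed
    where
    R-closed : Closed R
    R-closed {z} {w} z∈R w∉X z-w =
      decidable-stable (w ∈? R) (λ w∉R → no-frontier (w , w∉R , w∉X , z , z∈R , z-w))

  grow-reachable : ∀ {u} f R → (∀ {w} → w ∈ R → u ~ w) → ∀ {w} → w ∈ grow f R → u ~ w
  grow-reachable zero    R R-reachable w∈ = R-reachable w∈
  grow-reachable {u} (suc f) R R-reachable w∈ with any? (frontier? R)
  ... | no _ = R-reachable w∈
  ... | yes (x , _ , x∉X , z , z∈R , z-x) = grow-reachable f (R ∪ ⁅ x ⁆) R∪x-reachable w∈
    where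
    R∪x-reachable : ∀ {w} → w ∈ R ∪ ⁅ x ⁆ → u ~ w
    R∪x-reachable w∈ with x∈p∪q⁻ R ⁅ x ⁆ w∈
    ... | inj₁ w∈R = R-reachable w∈R
    ... | inj₂ w∈x rewrite x∈⁅y⁆⇒x≡y x w∈x = walk-snoc (R-reachable z∈R) z-x x∉X

  reach : Fin n → Subset n
  reach u = grow (suc n) ⁅ u ⁆

  reach-closed : ∀ u → Closed (reach u)
  reach-closed u = grow-closed (suc n) ⁅ u ⁆ (≤-trans (n<1+n n) (m≤n+m (suc n) _))

  ∈-reach⁺ : ∀ {u v} → u ~ v → v ∈ reach u
  ∈-reach⁺ {u} u~v = Closed-~ (reach-closed u) (grow-⊇ (suc n) ⁅ u ⁆ (x∈⁅x⁆ u)) u~v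

  ∈-reach⁻ : ∀ {u v} → u ∉ X → v ∈ reach u → u ~ v
  ∈-reach⁻ {u} u∉X = grow-reachable (suc n) ⁅ u ⁆ λ w∈u → subst (u ~_) (sym (x∈⁅y⁆⇒x≡y u w∈u)) (here u∉X)

  _~?_ : ∀ u v → Dec (u ~ v)
  u ~? v with u ∈? X | v ∈? reach u
  ... | yes u∈X | _       = no (λ u~v → walk-head u~v u∈X)
  ... | no  u∉X | yes v∈  = yes (∈-reach⁻ u∉X v∈)
  ... | no  _   | no  v∉  = no (v∉ ∘ ∈-reach⁺)

-- Pairwise sums

length*≤length*+sum : ∀ c x (ys : List ℕ) → All (λ y → c ≤ x + y) ys →
  length ys * c ≤ length ys * x + sum ys
length*≤length*+sum c x []       []             = z≤n
length*≤length*+sum c x (y ∷ ys) (c≤x+y ∷ rest) =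
  ≤-trans (+-mono-≤ c≤x+y (length*≤length*+sum c x ys rest))
          (≤-reflexive (regroup x y (sum ys) (length ys * x)))
  where
  regroup : ∀ x y s l → (x + y) + (l + s) ≡ (x + l) + (y + s)
  regroup = solve-∀

-- Double counting: summing c ≤ a + b over the L (L - 1) / 2 pairs counts each entry L - 1 times.
pred-length*≤pred-length* : ∀ c (xs : List ℕ) → AllPairs (λ a b → c ≤ a + b) xs →
  pred (length xs) * (length xs * c) ≤ pred (length xs) * (2 * sum xs)
pred-length*≤pred-length* c []           _               = z≤n
pred-length*≤pred-length* c (x ∷ [])     _               = z≤n
pred-length*≤pred-length* c (x ∷ y ∷ ys) (row ∷ pairs) = begin
  suc l * (suc (suc l) * c)            ≡⟨ expand-left l c ⟩
  l * (suc l * c) + 2 * (suc l * c)    ≤⟨ +-mono-≤ (pred-length*≤pred-length* c (y ∷ ys) pairs)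
                                                    (*-monoʳ-≤ 2 (length*≤length*+sum c x (y ∷ ys) row)) ⟩
  l * (2 * s) + 2 * (suc l * x + s)    ≡⟨ expand-right l x s ⟩
  suc l * (2 * (x + s))                ∎
  where
  open ≤-Reasoning
  l = length ys
  s = y + sum ys
  expand-left : ∀ l c → suc l * (suc (suc l) * c) ≡ l * (suc l * c) + 2 * (suc l * c)
  expand-left = solve-∀
  expand-right : ∀ l x s → l * (2 * s) + 2 * (suc l * x + s) ≡ suc l * (2 * (x + s))
  expand-right = solve-∀

length*≤2*sum : ∀ c (xs : List ℕ) → 2 ≤ length xs → AllPairs (λ a b → c ≤ a + b) xs →
  length xs * c ≤ 2 * sum xs
length*≤2*sum c (_ ∷ []) (s≤s ()) _
length*≤2*sum c xs@(_ ∷ _ ∷ _) _ pairs = *-cancelˡ-≤ (pred (length xs)) (pred-length*≤pred-length* c xs pairs)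

m≤⌈m/n⌉*n : ∀ m n .{{_ : NonZero n}} → m ≤ ⌈ m / n ⌉ * n
m≤⌈m/n⌉*n m n@(suc n-1) = +-cancelˡ-≤ n-1 m (⌈ m / n ⌉ * n) (begin
  n-1 + m                                 ≡⟨ +-comm n-1 m ⟩
  m + n-1                                 ≡⟨ cong (_∸ 1) (+-suc m n-1) ⟨
  m + n ∸ 1                               ≡⟨ m≡m%n+[m/n]*n (m + n ∸ 1) n ⟩
  (m + n ∸ 1) % n + ⌈ m / n ⌉ * n         ≤⟨ +-monoˡ-≤ _ (≤-pred (m%n<n (m + n ∸ 1) n)) ⟩
  n-1 + ⌈ m / n ⌉ * n                     ∎)
  where open ≤-Reasoning

length≤3+⌈4ℓ/t⌉ : ∀ ℓ t .{{_ : NonZero t}} (xs : List ℕ) →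
  AllPairs (λ a b → suc t ≤ a + b) xs → sum xs ≤ 2 * t + 2 * ℓ → length xs ≤ 3 + ⌈ 4 * ℓ / t ⌉
length≤3+⌈4ℓ/t⌉ ℓ t []           _     _ = z≤n
length≤3+⌈4ℓ/t⌉ ℓ t (_ ∷ [])     _     _ = s≤s z≤n
length≤3+⌈4ℓ/t⌉ ℓ t xs@(_ ∷ _ ∷ _) pairs sum≤ with length xs ≤? 3 + ⌈ 4 * ℓ / t ⌉
... | yes L≤ = L≤
... | no L≰ = contradiction L*[1+t]≤ (<⇒≱ (begin-strict
  2 * (2 * t + 2 * ℓ)          ≡⟨ double t ℓ ⟩
  4 * t + 4 * ℓ                ≤⟨ +-monoʳ-≤ (4 * t) (m≤⌈m/n⌉*n (4 * ℓ) t) ⟩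
  4 * t + d * t                <⟨ m<m+n (4 * t + d * t) (s≤s (z≤n {3 + d})) ⟩
  4 * t + d * t + (4 + d)      ≡⟨ factor t d ⟩
  (4 + d) * suc t              ≤⟨ *-monoˡ-≤ (suc t) (≰⇒> L≰) ⟩
  length xs * suc t            ∎))
  where
  open ≤-Reasoning
  d = ⌈ 4 * ℓ / t ⌉
  L*[1+t]≤ : length xs * suc t ≤ 2 * (2 * t + 2 * ℓ)
  L*[1+t]≤ = ≤-trans (length*≤2*sum (suc t) xs (s≤s (s≤s z≤n)) pairs) (*-monoʳ-≤ 2 sum≤)
  double : ∀ t ℓ → 2 * (2 * t + 2 * ℓ) ≡ 4 * t + 4 * ℓ
  double = solve-∀
  factor : ∀ t d → 4 * t + d * t + (4 + d) ≡ (4 + d) * suc t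
  factor = solve-∀

-- Trees of bags

count : ∀ {m} → (Fin m → Bool) → ℕ
count {zero}  f = 0
count {suc m} f = (if f zero then 1 else 0) + count (f ∘ suc)

count-cong : ∀ {m} {f g : Fin m → Bool} → (∀ i → f i ≡ g i) → count f ≡ count g
count-cong {zero}  f≗g = refl
count-cong {suc m} f≗g = cong₂ (λ b c → (if b then 1 else 0) + c) (f≗g zero) (count-cong (f≗g ∘ suc))

count-false : ∀ {m} {f : Fin m → Bool} → (∀ i → f i ≡ false) → count f ≡ 0
count-false {zero}  f≗false = refl
count-false {suc m} f≗false rewrite f≗false zero = count-false (f≗false ∘ suc)

count-+ : ∀ a b (f : Fin (a + b) → Bool) → count f ≡ count (f ∘ (_↑ˡ b)) + count (f ∘ (a ↑ʳ_))
count-+ zero    b f = refl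
count-+ (suc a) b f =
  trans (cong (first +_) (count-+ a b (f ∘ suc))) (sym (+-assoc first (count (f ∘ suc ∘ (_↑ˡ b))) _))
  where first = if f zero then 1 else 0

length-filter-tabulate : ∀ {A : Set} {P : A → Set} (P? : ∀ a → Dec (P a)) {m} (g : Fin m → A) →
  length (filter P? (tabulate g)) ≡ count (λ i → does (P? (g i)))
length-filter-tabulate P? {zero}  g = refl
length-filter-tabulate P? {suc m} g with does (P? (g zero))
... | true  = cong suc (length-filter-tabulate P? (g ∘ suc))
... | false = length-filter-tabulate P? (g ∘ suc)

numChildren≡count : ∀ {m} (T : RootedTree m) x → numChildren T x ≡ count (λ i → does (parent T i ≟ x))
numChildren≡count T x = length-filter-tabulate (λ i → parent T i ≟ x) id

count-≟-image : ∀ {a b c} (g : Fin b → Fin c) → (∀ {u v} → g u ≡ g v → u ≡ v) →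
  (f : Fin a → Fin b) (h : Fin a → Fin c) → (∀ j → h j ≡ g (f j)) →
  ∀ x → count (λ j → does (h j ≟ g x)) ≡ count (λ j → does (f j ≟ x))
count-≟-image g g-injective f h h≡g∘f x = count-cong λ j →
  does-⇔ (mk⇔ (λ eq → g-injective (trans (sym (h≡g∘f j)) eq)) (λ eq → trans (h≡g∘f j) (cong g eq)))
         (h j ≟ g x) (f j ≟ x)

count-≟-missed : ∀ {a c} (h : Fin a → Fin c) x → (∀ j → h j ≢ x) → count (λ j → does (h j ≟ x)) ≡ 0
count-≟-missed h x h≢x = count-false (λ j → dec-false (h j ≟ x) (h≢x j))

↑ˡ≢↑ʳ : ∀ {a b} (i : Fin a) (j : Fin b) → i ↑ˡ b ≢ a ↑ʳ j
↑ˡ≢↑ʳ {a} {b} i j eq with () ← trans (sym (splitAt-↑ˡ a i b)) (trans (cong (splitAt a) eq) (splitAt-↑ʳ a b j))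

record BagTree (n : ℕ) : Set where
  constructor bagTree
  field
    size  : ℕ
    shape : RootedTree size
    bags  : Fin (suc size) → Subset n
open BagTree public

leaf : Subset n → BagTree n
leaf R = bagTree 0 (record { parent = λ () ; parent-lt = λ () }) (λ _ → R)

Coherent : BagTree n → Set
Coherent T = ∀ v x y → v ∈ bags T x → v ∈ bags T y → Walk (TreeAdj (shape T)) (λ z → v ∈ bags T z) x y

leaf-coherent : (R : Subset n) → Coherent (leaf R)
leaf-coherent R v zero zero v∈ _ = here v∈

EdgesSatisfy : (Subset n → Subset n → Set) → BagTree n → Set
EdgesSatisfy _R_ T = ∀ i → bags T (parent (shape T) i) R bags T (suc i)

TreeAdj-sym : ∀ {m} {T : RootedTree m} {a b} → TreeAdj T a b → TreeAdj T b a
TreeAdj-sym (up i)   = down i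
TreeAdj-sym (down i) = up i

-- T₂ is hung below the root of T₁: the nodes of T₁ keep their numbers (inl), those of T₂ follow (inr).
module Glue (T₁ T₂ : BagTree n) where

  private
    m₁ = size T₁
    m₂ = size T₂
    p₁ = parent (shape T₁)
    p₂ = parent (shape T₂)

  M : ℕ
  M = m₁ + suc m₂

  inl : Fin (suc m₁) → Fin (suc M)
  inl x = x ↑ˡ suc m₂

  inr : Fin (suc m₂) → Fin (suc M)
  inr y = suc m₁ ↑ʳ y

  data NodeView : Fin (suc M) → Set where
    left  : ∀ x → NodeView (inl x)
    right : ∀ y → NodeView (inr y)

  node-view : ∀ x → NodeView x
  node-view x with splitAt (suc m₁) x in eq
  ... | inj₁ x₁ = subst NodeView (splitAt⁻¹-↑ˡ eq) (left x₁)
  ... | inj₂ y  = subst NodeView (splitAt⁻¹-↑ʳ eq) (right y)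

  -- The non-root node suc i is inl (suc j), the root of T₂, or inr (suc k).
  data EdgeView : Fin M → Set where
    left  : ∀ j → EdgeView (j ↑ˡ suc m₂)
    link  : EdgeView (m₁ ↑ʳ zero)
    right : ∀ k → EdgeView (m₁ ↑ʳ suc k)

  edge-view : ∀ i → EdgeView i
  edge-view i with splitAt m₁ i in eq
  ... | inj₁ j       = subst EdgeView (splitAt⁻¹-↑ˡ eq) (left j)
  ... | inj₂ zero    = subst EdgeView (splitAt⁻¹-↑ʳ eq) link
  ... | inj₂ (suc k) = subst EdgeView (splitAt⁻¹-↑ʳ eq) (right k)

  glued-parent : Fin M → Fin (suc M)
  glued-parent i with splitAt m₁ i
  ... | inj₁ j       = inl (p₁ j)
  ... | inj₂ zero    = zero
  ... | inj₂ (suc k) = inr (p₂ k)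

  parent-left : ∀ j → glued-parent (j ↑ˡ suc m₂) ≡ inl (p₁ j)
  parent-left j rewrite splitAt-↑ˡ m₁ j (suc m₂) = refl

  parent-link : glued-parent (m₁ ↑ʳ zero) ≡ zero
  parent-link rewrite splitAt-↑ʳ m₁ (suc m₂) zero = refl

  parent-right : ∀ k → glued-parent (m₁ ↑ʳ suc k) ≡ inr (p₂ k)
  parent-right k rewrite splitAt-↑ʳ m₁ (suc m₂) (suc k) = refl

  glued-parent-lt : ∀ i → toℕ (glued-parent i) ℕ.< suc (toℕ i)
  glued-parent-lt i with edge-view i
  ... | left j rewrite parent-left j | toℕ-↑ˡ (p₁ j) (suc m₂) | toℕ-↑ˡ j (suc m₂) = parent-lt (shape T₁) j
  ... | link rewrite parent-link = s≤s z≤n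
  ... | right k rewrite parent-right k | toℕ-↑ʳ (suc m₁) (p₂ k) | toℕ-↑ʳ m₁ (suc k) =
        s≤s (≤-trans (≤-reflexive (sym (+-suc m₁ (toℕ (p₂ k))))) (+-monoʳ-≤ m₁ (parent-lt (shape T₂) k)))

  glued-shape : RootedTree M
  glued-shape = record { parent = glued-parent ; parent-lt = glued-parent-lt }

  glue : BagTree n
  glue = bagTree M glued-shape (λ x → [ bags T₁ , bags T₂ ]′ (splitAt (suc m₁) x))

  bags-inl : ∀ x → bags glue (inl x) ≡ bags T₁ x
  bags-inl x rewrite splitAt-↑ˡ (suc m₁) x (suc m₂) = refl

  bags-inr : ∀ y → bags glue (inr y) ≡ bags T₂ y
  bags-inr y rewrite splitAt-↑ʳ (suc m₁) (suc m₂) y = refl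

  glue-bags : (Q : Subset n → Set) → (∀ x → Q (bags T₁ x)) → (∀ y → Q (bags T₂ y)) → ∀ x → Q (bags glue x)
  glue-bags Q Q₁ Q₂ x with node-view x
  ... | left x₁ = subst Q (sym (bags-inl x₁)) (Q₁ x₁)
  ... | right y = subst Q (sym (bags-inr y)) (Q₂ y)

  adj-inl : ∀ {a b} → TreeAdj (shape T₁) a b → TreeAdj glued-shape (inl a) (inl b)
  adj-inl (up j)   = subst (TreeAdj glued-shape (inl (suc j))) (parent-left j) (up (j ↑ˡ suc m₂))
  adj-inl (down j) = subst (λ z → TreeAdj glued-shape z (inl (suc j))) (parent-left j) (down (j ↑ˡ suc m₂))

  adj-inr : ∀ {a b} → TreeAdj (shape T₂) a b → TreeAdj glued-shape (inr a) (inr b)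
  adj-inr (up k)   = subst (TreeAdj glued-shape (inr (suc k))) (parent-right k) (up (m₁ ↑ʳ suc k))
  adj-inr (down k) = subst (λ z → TreeAdj glued-shape z (inr (suc k))) (parent-right k) (down (m₁ ↑ʳ suc k))

  adj-link : TreeAdj glued-shape zero (inr zero)
  adj-link = subst (λ z → TreeAdj glued-shape z (inr zero)) parent-link (down (m₁ ↑ʳ zero))

  glue-coherent : Coherent T₁ → Coherent T₂ →
    (∀ v x y → v ∈ bags T₁ x → v ∈ bags T₂ y → v ∈ bags T₁ zero × v ∈ bags T₂ zero) → Coherent glue
  glue-coherent coh₁ coh₂ shared v x y v∈x v∈y = walk (node-view x) (node-view y) v∈x v∈y
    where
    Path = Walk (TreeAdj glued-shape) (λ z → v ∈ bags glue z)
    into₁ : ∀ {a} → v ∈ bags T₁ a → v ∈ bags glue (inl a)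
    into₁ {a} = subst (v ∈_) (sym (bags-inl a))
    into₂ : ∀ {b} → v ∈ bags T₂ b → v ∈ bags glue (inr b)
    into₂ {b} = subst (v ∈_) (sym (bags-inr b))
    out₁ : ∀ {a} → v ∈ bags glue (inl a) → v ∈ bags T₁ a
    out₁ {a} = subst (v ∈_) (bags-inl a)
    out₂ : ∀ {b} → v ∈ bags glue (inr b) → v ∈ bags T₂ b
    out₂ {b} = subst (v ∈_) (bags-inr b)
    across : ∀ a b → v ∈ bags T₁ a → v ∈ bags T₂ b → Path (inl a) (inr b)
    across a b v∈a v∈b with v∈r₁ , v∈r₂ ← shared v a b v∈a v∈b =
      walk-++ (walk-map inl adj-inl into₁ (coh₁ v a zero v∈a v∈r₁))
              (step (into₁ v∈r₁) adj-link (walk-map inr adj-inr into₂ (coh₂ v zero b v∈r₂ v∈b)))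
    walk : ∀ {x y} → NodeView x → NodeView y → v ∈ bags glue x → v ∈ bags glue y → Path x y
    walk (left a)  (left b)  v∈x v∈y = walk-map inl adj-inl into₁ (coh₁ v a b (out₁ v∈x) (out₁ v∈y))
    walk (right a) (right b) v∈x v∈y = walk-map inr adj-inr into₂ (coh₂ v a b (out₂ v∈x) (out₂ v∈y))
    walk (left a)  (right b) v∈x v∈y = across a b (out₁ v∈x) (out₂ v∈y)
    walk (right a) (left b)  v∈x v∈y = walk-reverse TreeAdj-sym (across b a (out₁ v∈y) (out₂ v∈x))

  glue-edges : ∀ _R_ → EdgesSatisfy _R_ T₁ → EdgesSatisfy _R_ T₂ → bags T₁ zero R bags T₂ zero →
    EdgesSatisfy _R_ glue
  glue-edges _R_ E₁ E₂ E₀ i with edge-view i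
  ... | left j  = subst₂ _R_ (sym (trans (cong (bags glue) (parent-left j)) (bags-inl (p₁ j))))
                             (sym (bags-inl (suc j))) (E₁ j)
  ... | link    = subst₂ _R_ (sym (cong (bags glue) parent-link)) (sym (bags-inr zero)) E₀
  ... | right k = subst₂ _R_ (sym (trans (cong (bags glue) (parent-right k)) (bags-inr (p₂ k))))
                             (sym (bags-inr (suc k))) (E₂ k)

  private
    left-children : Fin (suc M) → ℕ
    left-children x = count (λ j → does (glued-parent (j ↑ˡ suc m₂) ≟ x))

    link-child : Fin (suc M) → ℕ
    link-child x = if does (glued-parent (m₁ ↑ʳ zero) ≟ x) then 1 else 0

    right-children : Fin (suc M) → ℕ
    right-children x = count (λ k → does (glued-parent (m₁ ↑ʳ suc k) ≟ x))

    numChildren-split : ∀ x → numChildren glued-shape x ≡ left-children x + (link-child x + right-children x)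
    numChildren-split x = trans (numChildren≡count glued-shape x) (count-+ m₁ (suc m₂) _)

    left-children-inl : ∀ x → left-children (inl x) ≡ numChildren (shape T₁) x
    left-children-inl x = trans (count-≟-image inl (↑ˡ-injective (suc m₂) _ _) p₁ _ parent-left x)
                                (sym (numChildren≡count (shape T₁) x))

    left-children-inr : ∀ y → left-children (inr y) ≡ 0
    left-children-inr y = count-≟-missed _ (inr y) (λ j eq → ↑ˡ≢↑ʳ (p₁ j) y (trans (sym (parent-left j)) eq))

    right-children-inl : ∀ x → right-children (inl x) ≡ 0
    right-children-inl x =
      count-≟-missed _ (inl x) (λ k eq → ↑ˡ≢↑ʳ x (p₂ k) (sym (trans (sym (parent-right k)) eq)))

    right-children-inr : ∀ y → right-children (inr y) ≡ numChildren (shape T₂) y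
    right-children-inr y = trans (count-≟-image inr (↑ʳ-injective (suc m₁) _ _) p₂ _ parent-right y)
                                 (sym (numChildren≡count (shape T₂) y))

    link-child-inl : ∀ x → link-child (inl (suc x)) ≡ 0
    link-child-inl x rewrite parent-link = refl

    link-child-inr : ∀ y → link-child (inr y) ≡ 0
    link-child-inr y rewrite parent-link = refl

  glue-children-root : numChildren glued-shape zero ≡ suc (numChildren (shape T₁) zero)
  glue-children-root = begin
    numChildren glued-shape zero                          ≡⟨ numChildren-split zero ⟩
    left-children zero + (link-child zero + right-children zero)
      ≡⟨ cong₂ (λ a b → a + (link-child zero + b)) (left-children-inl zero) (right-children-inl zero) ⟩
    numChildren (shape T₁) zero + (link-child zero + 0)
      ≡⟨ cong (λ b → numChildren (shape T₁) zero + (b + 0)) link-root ⟩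
    numChildren (shape T₁) zero + 1                       ≡⟨ +-comm _ 1 ⟩
    suc (numChildren (shape T₁) zero)                     ∎
    where
    open ≡-Reasoning
    link-root : link-child zero ≡ 1
    link-root rewrite parent-link = refl

  glue-children-nonroot : ∀ {d} → (∀ x → numChildren (shape T₁) (suc x) ≤ d) →
    (∀ y → numChildren (shape T₂) y ≤ d) →
    ∀ x → numChildren glued-shape (suc x) ≤ d
  glue-children-nonroot {d} bound₁ bound₂ x = nonroot (node-view (suc x)) (λ ())
    where
    nonroot : ∀ {z} → NodeView z → z ≢ zero → numChildren glued-shape z ≤ d
    nonroot (left zero) z≢0 = contradiction refl z≢0
    nonroot (left (suc a)) _ = ≤-trans (≤-reflexive (begin
      numChildren glued-shape (inl (suc a))                       ≡⟨ numChildren-split (inl (suc a)) ⟩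
      left-children (inl (suc a)) + (link-child (inl (suc a)) + right-children (inl (suc a)))
        ≡⟨ cong₂ _+_ (left-children-inl (suc a)) (cong₂ _+_ (link-child-inl a) (right-children-inl (suc a))) ⟩
      numChildren (shape T₁) (suc a) + 0                          ≡⟨ +-identityʳ _ ⟩
      numChildren (shape T₁) (suc a)                              ∎)) (bound₁ a)
      where open ≡-Reasoning
    nonroot (right b) _ = ≤-trans (≤-reflexive (begin
      numChildren glued-shape (inr b)                             ≡⟨ numChildren-split (inr b) ⟩
      left-children (inr b) + (link-child (inr b) + right-children (inr b))
        ≡⟨ cong₂ _+_ (left-children-inr b) (cong₂ _+_ (link-child-inr b) (right-children-inr b)) ⟩
      numChildren (shape T₂) b                                    ∎)) (bound₂ b)
      where open ≡-Reasoning

-- Greedy grouping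

module Grouping {n : ℕ} (Good : Subset n → Set) (good? : ∀ P → Dec (Good P)) where

  insert : Subset n → List (Subset n) → List (Subset n)
  insert P []       = P ∷ []
  insert P (Q ∷ Qs) with good? (P ∪ Q)
  ... | yes _ = insert (P ∪ Q) Qs
  ... | no  _ = Q ∷ insert P Qs

  ⋃-insert : ∀ P Qs → ⋃ (insert P Qs) ≡ P ∪ ⋃ Qs
  ⋃-insert P []       = refl
  ⋃-insert P (Q ∷ Qs) with good? (P ∪ Q)
  ... | yes _ = trans (⋃-insert (P ∪ Q) Qs) (∪-assoc P Q (⋃ Qs))
  ... | no  _ = trans (cong (Q ∪_) (⋃-insert P Qs)) (∪-left-comm Q P (⋃ Qs))

  insert-All : ∀ {I : Subset n → Set} → (∀ {P Q} → I P → I Q → Good (P ∪ Q) → I (P ∪ Q)) →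
    ∀ {P Qs} → I P → All I Qs → All I (insert P Qs)
  insert-All I-∪ {P} {[]}     IP []         = IP ∷ []
  insert-All I-∪ {P} {Q ∷ Qs} IP (IQ ∷ IQs) with good? (P ∪ Q)
  ... | yes good = insert-All I-∪ (I-∪ IP IQ good) IQs
  ... | no  _    = IQ ∷ insert-All I-∪ IP IQs

  insert-All-between : ∀ (R : Subset n → Set) {P} Qs → (∀ {M} → P ⊆ M → M ⊆ P ∪ ⋃ Qs → R M) →
    All R Qs → All R (insert P Qs)
  insert-All-between R []       R-between []         = R-between ⊆-refl (p⊆p∪q ⊥) ∷ []
  insert-All-between R {P} (Q ∷ Qs) R-between (RQ ∷ RQs) with good? (P ∪ Q)
  ... | yes _ = insert-All-between R Qs merged RQs
    where
    merged : ∀ {M} → P ∪ Q ⊆ M → M ⊆ (P ∪ Q) ∪ ⋃ Qs → R M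
    merged P∪Q⊆M M⊆ = R-between (P∪Q⊆M ∘ p⊆p∪q Q) (⊆-trans M⊆ (⊆-reflexive (∪-assoc P Q (⋃ Qs))))
  ... | no  _ = RQ ∷ insert-All-between R Qs kept RQs
    where
    kept : ∀ {M} → P ⊆ M → M ⊆ P ∪ ⋃ Qs → R M
    kept P⊆M M⊆ = R-between P⊆M (⊆-trans M⊆ (∪-monoʳ-⊆ P (q⊆p∪q Q (⋃ Qs))))

  Separated : Subset n → Subset n → Set
  Separated P Q = Disjoint P Q × ¬ Good (P ∪ Q)

  module _ (Good-antitone : ∀ {P Q} → P ⊆ Q → Good Q → Good P) where

    insert-separated : ∀ P Qs → All (Disjoint P) Qs → AllPairs Separated Qs →
      AllPairs Separated (insert P Qs)
    insert-separated P []       []           []           = [] ∷ []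
    insert-separated P (Q ∷ Qs) (P#Q ∷ P#Qs) (Q-sep ∷ sep) with good? (P ∪ Q)
    ... | yes _ = insert-separated (P ∪ Q) Qs (All.zipWith P∪Q# (P#Qs , All.map proj₁ Q-sep)) sep
      where
      P∪Q# : ∀ {R} → Disjoint P R × Disjoint Q R → Disjoint (P ∪ Q) R
      P∪Q# (P#R , Q#R) = Disjoint-∪ˡ P#R Q#R
    ... | no bad = insert-All-between (Separated Q) Qs between Q-sep ∷ insert-separated P Qs P#Qs sep
      where
      between : ∀ {M} → P ⊆ M → M ⊆ P ∪ ⋃ Qs → Separated Q M
      between {M} P⊆M M⊆ = Q#M , λ good → bad (Good-antitone P∪Q⊆Q∪M good)
        where
        Q#M : Disjoint Q M
        Q#M x∈Q x∈M =
          [ Disjoint-sym P#Q x∈Q , Disjoint-⋃ (All.map proj₁ Q-sep) x∈Q ]′ (x∈p∪q⁻ P (⋃ Qs) (M⊆ x∈M))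
        P∪Q⊆Q∪M : P ∪ Q ⊆ Q ∪ M
        P∪Q⊆Q∪M = ∪-least (q⊆p∪q Q M ∘ P⊆M) (p⊆p∪q M)

-- The construction

module Construction (ℓ t : ℕ) .{{_ : NonZero t}} {n : ℕ} (G : Graph n)
  (separable : ∀ (S : Subset n) → ∣ S ∣ ≡ 2 * t + 2 * ℓ →
     ∃ λ (X : Subset n) → ∣ X ∣ ≤ ℓ × ComponentsMeetAtMost G X S t) where

  width : ℕ
  width = 2 * t + 3 * ℓ

  branching : ℕ
  branching = 3 + ⌈ 4 * ℓ / t ⌉

  SlickPair : Subset n → Subset n → Set
  SlickPair P Q = ∀ v → v ∈ P → v ∈ Q → ∃ λ u → Adj G v u × u ∈ Q × u ∉ P

  record Interface (A W : Subset n) : Set where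
    field
      W⊆A        : W ⊆ A
      ∣W∣≤t+ℓ     : ∣ W ∣ ≤ t + ℓ
      W-anchored : ∀ {w} → w ∈ W → ∃ λ u → u ∈ A × u ∉ W × Adj G w u
      A-closed   : ∀ {v u} → v ∈ A → v ∉ W → Adj G v u → u ∈ A

  record Decomposition (A W : Subset n) : Set where
    field
      bag-tree        : BagTree n
      W⊆root          : W ⊆ bags bag-tree zero
      bags⊆A          : ∀ x → bags bag-tree x ⊆ A
      covers-edges    : ∀ u v → u ∈ A → v ∈ A → Adj G u v →
                          ∃ λ x → u ∈ bags bag-tree x × v ∈ bags bag-tree x
      covers-vertices : ∀ v → v ∈ A → ∃ λ x → v ∈ bags bag-tree x
      coherent        : Coherent bag-tree
      small           : ∀ x → ∣ bags bag-tree x ∣ ≤ width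
      few-children    : ∀ x → numChildren (shape bag-tree) x ≤ branching
      slick           : EdgesSatisfy SlickPair bag-tree
      root-anchors    : ∀ {w} → w ∈ W → ∃ λ u → Adj G w u × u ∈ bags bag-tree zero × u ∉ W

  leaf-decomposition : ∀ {A W} → Interface A W → ∣ A ∣ ≤ width → Decomposition A W
  leaf-decomposition {A} {W} iface ∣A∣≤ = record
    { bag-tree        = leaf A
    ; W⊆root          = W⊆A
    ; bags⊆A          = λ _ → ⊆-refl
    ; covers-edges    = λ u v u∈A v∈A _ → zero , u∈A , v∈A
    ; covers-vertices = λ v v∈A → zero , v∈A
    ; coherent        = leaf-coherent A
    ; small           = λ _ → ∣A∣≤
    ; few-children    = λ { zero → z≤n }
    ; slick           = λ ()
    ; root-anchors    = λ w∈W → let u , u∈A , u∉W , w-u = W-anchored w∈W in u , w-u , u∈A , u∉W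
    }
    where open Interface iface

  module Split (A W : Subset n) (iface : Interface A W) (large : ¬ ∣ A ∣ ≤ width)
    (recurse : ∀ A′ W′ → ∣ A′ ─ W′ ∣ < ∣ A ─ W ∣ → Interface A′ W′ → Decomposition A′ W′) where

    open Interface iface

    -- Opaque, so that type checking never unfolds the chosen sets.
    abstract
      anchors : ∃ λ N → N ⊆ A ─ W × ∣ N ∣ ≤ ∣ W ∣ × (∀ {w} → w ∈ W → ∃ λ u → u ∈ N × Adj G w u)
      anchors = witness-set (Adj G) W λ w∈W →
        let u , u∈A , u∉W , w-u = W-anchored w∈W in u , x∈p∧x∉q⇒x∈p─q u∈A u∉W , w-u

    N : Subset n
    N = proj₁ anchors

    N⊆A─W : N ⊆ A ─ W
    N⊆A─W = proj₁ (proj₂ anchors)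

    ∣N∣≤∣W∣ : ∣ N ∣ ≤ ∣ W ∣
    ∣N∣≤∣W∣ = proj₁ (proj₂ (proj₂ anchors))

    N-anchors : ∀ {w} → w ∈ W → ∃ λ u → u ∈ N × Adj G w u
    N-anchors = proj₂ (proj₂ (proj₂ anchors))

    ∣W∪N∣≤2t+2ℓ : ∣ W ∪ N ∣ ≤ 2 * t + 2 * ℓ
    ∣W∪N∣≤2t+2ℓ = begin
      ∣ W ∪ N ∣           ≤⟨ ∣p∪q∣≤∣p∣+∣q∣ W N ⟩
      ∣ W ∣ + ∣ N ∣       ≤⟨ +-mono-≤ ∣W∣≤t+ℓ (≤-trans ∣N∣≤∣W∣ ∣W∣≤t+ℓ) ⟩
      (t + ℓ) + (t + ℓ)   ≡⟨ double t ℓ ⟩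
      2 * t + 2 * ℓ       ∎
      where
      open ≤-Reasoning
      double : ∀ t ℓ → (t + ℓ) + (t + ℓ) ≡ 2 * t + 2 * ℓ
      double = solve-∀

    2t+2ℓ≤∣A∣ : 2 * t + 2 * ℓ ≤ ∣ A ∣
    2t+2ℓ≤∣A∣ = ≤-trans (+-monoʳ-≤ (2 * t) (*-monoˡ-≤ ℓ (n≤1+n 2))) (<⇒≤ (≰⇒> large))

    abstract
      sample : ∃ λ S → W ∪ N ⊆ S × S ⊆ A × ∣ S ∣ ≡ 2 * t + 2 * ℓ
      sample = ∃-between-of-size (∪-least W⊆A (p─q⊆p A W ∘ N⊆A─W)) ∣W∪N∣≤2t+2ℓ 2t+2ℓ≤∣A∣

    S : Subset n
    S = proj₁ sample

    W∪N⊆S : W ∪ N ⊆ S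
    W∪N⊆S = proj₁ (proj₂ sample)

    S⊆A : S ⊆ A
    S⊆A = proj₁ (proj₂ (proj₂ sample))

    ∣S∣≡2t+2ℓ : ∣ S ∣ ≡ 2 * t + 2 * ℓ
    ∣S∣≡2t+2ℓ = proj₂ (proj₂ (proj₂ sample))

    abstract
      separation : ∃ λ (X : Subset n) → ∣ X ∣ ≤ ℓ × ComponentsMeetAtMost G X S t
      separation = separable S ∣S∣≡2t+2ℓ

    X : Subset n
    X = proj₁ separation

    X-separates : ComponentsMeetAtMost G X S t
    X-separates = proj₂ (proj₂ separation)

    XA : Subset n
    XA = X ∩ A

    ∣XA∣≤ℓ : ∣ XA ∣ ≤ ℓ
    ∣XA∣≤ℓ = ≤-trans (∣p∩q∣≤∣p∣ X A) (proj₁ (proj₂ separation))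

    R : Subset n
    R = S ∪ XA

    R⊆A : R ⊆ A
    R⊆A = ∪-least S⊆A (p∩q⊆q X A)

    ∣R∣≤width : ∣ R ∣ ≤ width
    ∣R∣≤width = begin
      ∣ S ∪ XA ∣                ≤⟨ ∣p∪q∣≤∣p∣+∣q∣ S XA ⟩
      ∣ S ∣ + ∣ XA ∣            ≤⟨ +-mono-≤ (≤-reflexive ∣S∣≡2t+2ℓ) ∣XA∣≤ℓ ⟩
      2 * t + 2 * ℓ + ℓ         ≡⟨ regroup t ℓ ⟩
      2 * t + 3 * ℓ             ∎
      where
      open ≤-Reasoning
      regroup : ∀ t ℓ → 2 * t + 2 * ℓ + ℓ ≡ 2 * t + 3 * ℓ
      regroup = solve-∀

    S⊆R : S ⊆ R
    S⊆R = p⊆p∪q XA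

    W⊆R : W ⊆ R
    W⊆R = S⊆R ∘ W∪N⊆S ∘ p⊆p∪q N

    Rest : Subset n
    Rest = A ─ R

    Rest⁻ : ∀ {v} → v ∈ Rest → v ∈ A × v ∉ R
    Rest⁻ = x∈p─q⁻ A R

    Rest⊆A : Rest ⊆ A
    Rest⊆A = proj₁ ∘ Rest⁻

    Rest-∉R : ∀ {v} → v ∈ Rest → v ∉ R
    Rest-∉R = proj₂ ∘ Rest⁻

    Rest-∉X : ∀ {v} → v ∈ Rest → v ∉ X
    Rest-∉X v∈Rest v∈X = Rest-∉R v∈Rest (q⊆p∪q S XA (x∈p∩q⁺ (v∈X , Rest⊆A v∈Rest)))

    Rest-∉W : ∀ {v} → v ∈ Rest → v ∉ W
    Rest-∉W v∈Rest = Rest-∉R v∈Rest ∘ W⊆R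

    open Reachability G X

    in-class? : ∀ v u → Dec (u ∈ Rest × v ~ u)
    in-class? v u = u ∈? Rest ×-dec v ~? u

    class : Fin n → Subset n
    class v = subset (in-class? v)

    Seen : Subset n → Fin n → Set
    Seen P s = s ∈ S × ∃ λ g → g ∈ P × g ~ s

    seen? : ∀ P s → Dec (Seen P s)
    seen? P s = s ∈? S ×-dec any? (λ g → g ∈? P ×-dec g ~? s)

    seen : Subset n → Subset n
    seen P = subset (seen? P)

    seen⁻ : ∀ {P s} → s ∈ seen P → Seen P s
    seen⁻ {P} = ∈-subset⁻ (seen? P)

    seen⁺ : ∀ {P s} → Seen P s → s ∈ seen P
    seen⁺ {P} = ∈-subset⁺ (seen? P)

    seen⊆S : ∀ P → seen P ⊆ S
    seen⊆S P = proj₁ ∘ seen⁻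

    seen-mono : ∀ {P Q} → P ⊆ Q → seen P ⊆ seen Q
    seen-mono P⊆Q s∈ with s∈S , g , g∈P , g~s ← seen⁻ s∈ = seen⁺ (s∈S , g , P⊆Q g∈P , g~s)

    seen-∪ : ∀ P Q → seen (P ∪ Q) ⊆ seen P ∪ seen Q
    seen-∪ P Q s∈ with s∈S , g , g∈P∪Q , g~s ← seen⁻ s∈ with x∈p∪q⁻ P Q g∈P∪Q
    ... | inj₁ g∈P = p⊆p∪q (seen Q) (seen⁺ (s∈S , g , g∈P , g~s))
    ... | inj₂ g∈Q = q⊆p∪q (seen P) (seen Q) (seen⁺ (s∈S , g , g∈Q , g~s))

    -- The budget t + ℓ is the interface size: the boundary of a group H lies in seen H ∪ XA.
    Good : Subset n → Set
    Good P = ∣ seen P ∣ + ∣ XA ∣ ≤ t + ℓ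

    good? : ∀ P → Dec (Good P)
    good? P = ∣ seen P ∣ + ∣ XA ∣ ≤? t + ℓ

    Good-antitone : ∀ {P Q} → P ⊆ Q → Good Q → Good P
    Good-antitone P⊆Q = ≤-trans (+-monoˡ-≤ ∣ XA ∣ (p⊆q⇒∣p∣≤∣q∣ (seen-mono P⊆Q)))

    Saturated : Subset n → Set
    Saturated P = ∀ {g h} → g ∈ P → h ∈ Rest → g ~ h → h ∈ P

    Admissible : Subset n → Set
    Admissible P = Good P × Saturated P × P ⊆ Rest

    open Grouping Good good?

    class⁻ : ∀ v {u} → u ∈ class v → u ∈ Rest × v ~ u
    class⁻ v = ∈-subset⁻ (in-class? v)

    class⁺ : ∀ {v u} → u ∈ Rest → v ~ u → u ∈ class v
    class⁺ {v} u∈Rest v~u = ∈-subset⁺ (in-class? v) (u∈Rest , v~u)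

    class-admissible : ∀ {v} → v ∈ Rest → Admissible (class v)
    class-admissible {v} v∈Rest = good , saturated , proj₁ ∘ class⁻ v
      where
      saturated : Saturated (class v)
      saturated g∈ h∈Rest g~h = class⁺ h∈Rest (~-trans (proj₂ (class⁻ v g∈)) g~h)
      v~seen : ∀ u → u ∈ seen (class v) → v ~ u
      v~seen u u∈ with _ , g , g∈ , g~u ← seen⁻ u∈ = ~-trans (proj₂ (class⁻ v g∈)) g~u
      good : Good (class v)
      good = +-mono-≤ (X-separates v (Rest-∉X v∈Rest) (seen (class v)) (seen⊆S (class v)) v~seen) ∣XA∣≤ℓ

    Admissible-∪ : ∀ {P Q} → Admissible P → Admissible Q → Good (P ∪ Q) → Admissible (P ∪ Q)
    Admissible-∪ {P} {Q} (_ , P-sat , P⊆Rest) (_ , Q-sat , Q⊆Rest) good =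
      good , saturated , ∪-least P⊆Rest Q⊆Rest
      where
      saturated : Saturated (P ∪ Q)
      saturated g∈ h∈Rest g~h with x∈p∪q⁻ P Q g∈
      ... | inj₁ g∈P = p⊆p∪q Q (P-sat g∈P h∈Rest g~h)
      ... | inj₂ g∈Q = q⊆p∪q P Q (Q-sat g∈Q h∈Rest g~h)

    class-disjoint : ∀ {v} Hs → v ∈ Rest → v ∉ ⋃ Hs → All Admissible Hs → All (Disjoint (class v)) Hs
    class-disjoint []       _      _     []                = []
    class-disjoint {v} (H ∷ Hs) v∈Rest v∉⋃ ((_ , H-sat , _) ∷ adm) =
      (λ u∈class u∈H → v∉⋃ (p⊆p∪q (⋃ Hs) (H-sat u∈H v∈Rest (~-sym (proj₂ (class⁻ v u∈class))))))
      ∷ class-disjoint Hs v∈Rest (v∉⋃ ∘ q⊆p∪q H (⋃ Hs)) adm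

    add : Fin n → List (Subset n) → List (Subset n)
    add v Hs with v ∈? Rest ×-dec ¬? (v ∈? ⋃ Hs)
    ... | yes _ = insert (class v) Hs
    ... | no  _ = Hs

    add-admissible : ∀ v Hs → All Admissible Hs → All Admissible (add v Hs)
    add-admissible v Hs adm with v ∈? Rest ×-dec ¬? (v ∈? ⋃ Hs)
    ... | yes (v∈Rest , _) = insert-All Admissible-∪ (class-admissible v∈Rest) adm
    ... | no  _            = adm

    add-separated : ∀ v Hs → All Admissible Hs → AllPairs Separated Hs → AllPairs Separated (add v Hs)
    add-separated v Hs adm sep with v ∈? Rest ×-dec ¬? (v ∈? ⋃ Hs)
    ... | yes (v∈Rest , v∉⋃) =
      insert-separated Good-antitone (class v) Hs (class-disjoint Hs v∈Rest v∉⋃ adm) sep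
    ... | no  _              = sep

    add-⊇ : ∀ v Hs → ⋃ Hs ⊆ ⋃ (add v Hs)
    add-⊇ v Hs u∈ with v ∈? Rest ×-dec ¬? (v ∈? ⋃ Hs)
    ... | yes _ = subst (_ ∈_) (sym (⋃-insert (class v) Hs)) (q⊆p∪q (class v) (⋃ Hs) u∈)
    ... | no  _ = u∈

    add-∋ : ∀ v Hs → v ∈ Rest → v ∈ ⋃ (add v Hs)
    add-∋ v Hs v∈Rest with v ∈? Rest ×-dec ¬? (v ∈? ⋃ Hs)
    ... | yes _ = subst (v ∈_) (sym (⋃-insert (class v) Hs))
                    (p⊆p∪q (⋃ Hs) (class⁺ v∈Rest (here (Rest-∉X v∈Rest))))
    ... | no ¬new = decidable-stable (v ∈? ⋃ Hs) (λ v∉⋃ → ¬new (v∈Rest , v∉⋃))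

    groups-of : List (Fin n) → List (Subset n)
    groups-of = foldr add []

    groups-of-admissible : ∀ vs → All Admissible (groups-of vs)
    groups-of-admissible []       = []
    groups-of-admissible (v ∷ vs) = add-admissible v _ (groups-of-admissible vs)

    groups-of-separated : ∀ vs → AllPairs Separated (groups-of vs)
    groups-of-separated []       = []
    groups-of-separated (v ∷ vs) = add-separated v _ (groups-of-admissible vs) (groups-of-separated vs)

    groups-of-cover : ∀ vs {v} → v ∈ₗ vs → v ∈ Rest → v ∈ ⋃ (groups-of vs)
    groups-of-cover (v ∷ vs) (here refl) v∈Rest = add-∋ v _ v∈Rest
    groups-of-cover (u ∷ vs) (there v∈vs) v∈Rest = add-⊇ u _ (groups-of-cover vs v∈vs v∈Rest)

    groups : List (Subset n)
    groups = groups-of (allFin n)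

    groups-admissible : All Admissible groups
    groups-admissible = groups-of-admissible (allFin n)

    groups-separated : AllPairs Separated groups
    groups-separated = groups-of-separated (allFin n)

    Rest⊆⋃groups : Rest ⊆ ⋃ groups
    Rest⊆⋃groups {v} = groups-of-cover (allFin n) (∈-allFin v)

    seen-disjoint : ∀ {P Q} → Admissible P → Admissible Q → Disjoint P Q → Disjoint (seen P) (seen Q)
    seen-disjoint (_ , P-sat , _) (_ , _ , Q⊆Rest) P#Q s∈P s∈Q
      with _ , g , g∈P , g~s ← seen⁻ s∈P | _ , h , h∈Q , h~s ← seen⁻ s∈Q
      = P#Q (P-sat g∈P (Q⊆Rest h∈Q) (~-trans g~s (~-sym h~s))) h∈Q

    seen-pairwise-disjoint : ∀ Hs → All Admissible Hs → AllPairs Separated Hs →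
      AllPairs Disjoint (map seen Hs)
    seen-pairwise-disjoint []       []           []           = []
    seen-pairwise-disjoint (H ∷ Hs) (adm ∷ adms) (seps ∷ sep) =
      All.map⁺ (All.zipWith seen-H# (adms , seps)) ∷ seen-pairwise-disjoint Hs adms sep
      where
      seen-H# : ∀ {Q} → Admissible Q × Separated H Q → Disjoint (seen H) (seen Q)
      seen-H# (adm′ , H#Q , _) = seen-disjoint adm adm′ H#Q

    separated-seen : ∀ {P Q} → Separated P Q → suc t ≤ ∣ seen P ∣ + ∣ seen Q ∣
    separated-seen {P} {Q} (_ , bad) = +-cancelʳ-≤ ℓ (suc t) _ (begin
      suc t + ℓ                            ≡⟨⟩
      suc (t + ℓ)                          ≤⟨ ≰⇒> bad ⟩
      ∣ seen (P ∪ Q) ∣ + ∣ XA ∣            ≤⟨ +-mono-≤ (p⊆q⇒∣p∣≤∣q∣ (seen-∪ P Q)) ∣XA∣≤ℓ ⟩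
      ∣ seen P ∪ seen Q ∣ + ℓ              ≤⟨ +-monoˡ-≤ ℓ (∣p∪q∣≤∣p∣+∣q∣ (seen P) (seen Q)) ⟩
      ∣ seen P ∣ + ∣ seen Q ∣ + ℓ          ∎)
      where open ≤-Reasoning

    few-groups : length groups ≤ branching
    few-groups = subst (_≤ branching) (trans (length-map ∣_∣ (map seen groups)) (length-map seen groups))
      (length≤3+⌈4ℓ/t⌉ ℓ t (map ∣_∣ (map seen groups))
        (AllPairs.map⁺ (AllPairs.map⁺ (AllPairs.map separated-seen groups-separated)))
        (begin
          sum (map ∣_∣ (map seen groups))
            ≡⟨ ∣⋃∣≡sum (seen-pairwise-disjoint groups groups-admissible groups-separated) ⟨
          ∣ ⋃ (map seen groups) ∣
            ≤⟨ p⊆q⇒∣p∣≤∣q∣ (⋃-least {ps = map seen groups} (All.map⁺ (All.tabulate (λ {H} _ → seen⊆S H)))) ⟩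
          ∣ S ∣                             ≡⟨ ∣S∣≡2t+2ℓ ⟩
          2 * t + 2 * ℓ                     ∎))
      where open ≤-Reasoning

    on-boundary? : ∀ H u → Dec (u ∈ R × ∃ λ g → g ∈ H × Adj G g u)
    on-boundary? H u = u ∈? R ×-dec any? (λ g → g ∈? H ×-dec Adj? g u)

    boundary : Subset n → Subset n
    boundary H = subset (on-boundary? H)

    boundary⁻ : ∀ {H u} → u ∈ boundary H → u ∈ R × ∃ λ g → g ∈ H × Adj G g u
    boundary⁻ {H} = ∈-subset⁻ (on-boundary? H)

    boundary⁺ : ∀ {H u g} → u ∈ R → g ∈ H → Adj G g u → u ∈ boundary H
    boundary⁺ {H} u∈R g∈H g-u = ∈-subset⁺ (on-boundary? H) (u∈R , _ , g∈H , g-u)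

    boundary⊆R : ∀ H → boundary H ⊆ R
    boundary⊆R H = proj₁ ∘ boundary⁻

    closure : Subset n → Subset n
    closure H = H ∪ boundary H

    closure⊆A : ∀ {H} → H ⊆ Rest → closure H ⊆ A
    closure⊆A {H} H⊆Rest = ∪-least (Rest⊆A ∘ H⊆Rest) (R⊆A ∘ boundary⊆R H)

    closure─boundary⊆H : ∀ H → closure H ─ boundary H ⊆ H
    closure─boundary⊆H H v∈ with v∈closure , v∉boundary ← x∈p─q⁻ (closure H) (boundary H) v∈
      with x∈p∪q⁻ H (boundary H) v∈closure
    ... | inj₁ v∈H        = v∈H
    ... | inj₂ v∈boundary = contradiction v∈boundary v∉boundary

    closure∩R⊆boundary : ∀ {H} → H ⊆ Rest → ∀ {v} → v ∈ closure H → v ∈ R → v ∈ boundary H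
    closure∩R⊆boundary {H} H⊆Rest v∈closure v∈R with x∈p∪q⁻ H (boundary H) v∈closure
    ... | inj₁ v∈H        = contradiction v∈R (Rest-∉R (H⊆Rest v∈H))
    ... | inj₂ v∈boundary = v∈boundary

    boundary⊆seen∪XA : ∀ {H} → H ⊆ Rest → boundary H ⊆ seen H ∪ XA
    boundary⊆seen∪XA {H} H⊆Rest {u} u∈ with u∈R , g , g∈H , g-u ← boundary⁻ u∈ with u ∈? X
    ... | yes u∈X = q⊆p∪q (seen H) XA (x∈p∩q⁺ (u∈X , R⊆A u∈R))
    ... | no  u∉X = p⊆p∪q XA (seen⁺ (u∈S , g , g∈H , step (Rest-∉X (H⊆Rest g∈H)) g-u (here u∉X)))
      where
      u∈S : u ∈ S
      u∈S with x∈p∪q⁻ S XA u∈R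
      ... | inj₁ u∈S  = u∈S
      ... | inj₂ u∈XA = contradiction (proj₁ (x∈p∩q⁻ X A u∈XA)) u∉X

    child-interface : ∀ {H} → Admissible H → Interface (closure H) (boundary H)
    child-interface {H} (good , H-sat , H⊆Rest) = record
      { W⊆A        = q⊆p∪q H (boundary H)
      ; ∣W∣≤t+ℓ     = ≤-trans (p⊆q⇒∣p∣≤∣q∣ (boundary⊆seen∪XA H⊆Rest))
                             (≤-trans (∣p∪q∣≤∣p∣+∣q∣ (seen H) XA) good)
      ; W-anchored = anchored
      ; A-closed   = closed
      }
      where
      anchored : ∀ {u} → u ∈ boundary H → ∃ λ g → g ∈ closure H × g ∉ boundary H × Adj G u g
      anchored u∈ with _ , g , g∈H , g-u ← boundary⁻ u∈ =
        g , p⊆p∪q (boundary H) g∈H , Rest-∉R (H⊆Rest g∈H) ∘ boundary⊆R H , Adj-sym g-u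
      closed : ∀ {v u} → v ∈ closure H → v ∉ boundary H → Adj G v u → u ∈ closure H
      closed {v} {u} v∈closure v∉boundary v-u
        with v∈H ← closure─boundary⊆H H (x∈p∧x∉q⇒x∈p─q v∈closure v∉boundary) with u ∈? R
      ... | yes u∈R = q⊆p∪q H (boundary H) (boundary⁺ u∈R v∈H v-u)
      ... | no  u∉R =
        p⊆p∪q (boundary H) (H-sat v∈H u∈Rest (step (Rest-∉X v∈Rest) v-u (here (Rest-∉X u∈Rest))))
        where
        v∈Rest = H⊆Rest v∈H
        u∈Rest = x∈p∧x∉q⇒x∈p─q (A-closed (Rest⊆A v∈Rest) (Rest-∉W v∈Rest) v-u) u∉R

    child-smaller : ∀ {H} → Admissible H → ∣ closure H ─ boundary H ∣ < ∣ A ─ W ∣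
    child-smaller {H} (_ , _ , H⊆Rest) = p⊂q⇒∣p∣<∣q∣ (child⊆ , s , s∈A─W , s∉child)
      where
      ∣W∣<∣S∣ : ∣ W ∣ < ∣ S ∣
      ∣W∣<∣S∣ = ≤-<-trans ∣W∣≤t+ℓ (<-≤-trans (t+ℓ<2t+2ℓ t ℓ) (≤-reflexive (sym ∣S∣≡2t+2ℓ)))
        where
        t+ℓ<2t+2ℓ : ∀ t ℓ .{{_ : NonZero t}} → t + ℓ < 2 * t + 2 * ℓ
        t+ℓ<2t+2ℓ (suc t-1) ℓ = ≤-trans (m≤m+n (suc (suc t-1 + ℓ)) (t-1 + ℓ)) (≤-reflexive (regroup t-1 ℓ))
          where
          regroup : ∀ t-1 ℓ → suc (suc t-1 + ℓ) + (t-1 + ℓ) ≡ 2 * suc t-1 + 2 * ℓ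
          regroup = solve-∀
      s = proj₁ (∣p∣<∣q∣⇒∃∈q∉p W S ∣W∣<∣S∣)
      s∈S = proj₁ (proj₂ (∣p∣<∣q∣⇒∃∈q∉p W S ∣W∣<∣S∣))
      s∉W = proj₂ (proj₂ (∣p∣<∣q∣⇒∃∈q∉p W S ∣W∣<∣S∣))
      s∈A─W : s ∈ A ─ W
      s∈A─W = x∈p∧x∉q⇒x∈p─q (S⊆A s∈S) s∉W
      child⊆ : closure H ─ boundary H ⊆ A ─ W
      child⊆ v∈ = let v∈Rest = H⊆Rest (closure─boundary⊆H H v∈) in
        x∈p∧x∉q⇒x∈p─q (Rest⊆A v∈Rest) (Rest-∉W v∈Rest)
      s∉child : s ∉ closure H ─ boundary H
      s∉child s∈ = Rest-∉R (H⊆Rest (closure─boundary⊆H H s∈)) (S⊆R s∈S)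

    child : ∀ {H} → Admissible H → Decomposition (closure H) (boundary H)
    child {H} adm = recurse (closure H) (boundary H) (child-smaller adm) (child-interface adm)

    record Assembled (Hs : List (Subset n)) (T : BagTree n) : Set where
      field
        root≡R          : bags T zero ≡ R
        bags⊆R∪⋃        : ∀ x → bags T x ⊆ R ∪ ⋃ Hs
        bags⊆A          : ∀ x → bags T x ⊆ A
        coherent        : Coherent T
        small           : ∀ x → ∣ bags T x ∣ ≤ width
        root-children   : numChildren (shape T) zero ≡ length Hs
        few-children    : ∀ x → numChildren (shape T) (suc x) ≤ branching
        slick           : EdgesSatisfy SlickPair T
        covers-edges    : ∀ {v} → v ∈ ⋃ Hs → ∀ u → u ∈ A → Adj G v u →
                            ∃ λ x → v ∈ bags T x × u ∈ bags T x
        covers-vertices : ∀ {v} → v ∈ ⋃ Hs → ∃ λ x → v ∈ bags T x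

    root-assembled : Assembled [] (leaf R)
    root-assembled = record
      { root≡R          = refl
      ; bags⊆R∪⋃        = λ _ → p⊆p∪q ⊥
      ; bags⊆A          = λ _ → R⊆A
      ; coherent        = leaf-coherent R
      ; small           = λ _ → ∣R∣≤width
      ; root-children   = refl
      ; few-children    = λ ()
      ; slick           = λ ()
      ; covers-edges    = λ v∈⊥ → contradiction v∈⊥ ∉⊥
      ; covers-vertices = λ v∈⊥ → contradiction v∈⊥ ∉⊥
      }

    module Attach {H Hs T} (adm : Admissible H) (H#Hs : Disjoint H (⋃ Hs)) (asm : Assembled Hs T) where

      open Assembled asm
      module D = Decomposition (child adm)
      open Glue T D.bag-tree

      H⊆Rest : H ⊆ Rest
      H⊆Rest = proj₂ (proj₂ adm)

      H∉R∪⋃ : ∀ {v} → v ∈ H → v ∉ R ∪ ⋃ Hs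
      H∉R∪⋃ v∈H v∈ with x∈p∪q⁻ R (⋃ Hs) v∈
      ... | inj₁ v∈R = Rest-∉R (H⊆Rest v∈H) v∈R
      ... | inj₂ v∈⋃ = H#Hs v∈H v∈⋃

      bags⊆R∪⋃H∷Hs : ∀ y → bags D.bag-tree y ⊆ R ∪ ⋃ (H ∷ Hs)
      bags⊆R∪⋃H∷Hs y = ⊆-trans (D.bags⊆A y) (∪-least (q⊆p∪q R _ ∘ p⊆p∪q (⋃ Hs)) (p⊆p∪q _ ∘ boundary⊆R H))

      shared : ∀ v x y → v ∈ bags T x → v ∈ bags D.bag-tree y → v ∈ bags T zero × v ∈ bags D.bag-tree zero
      shared v x y v∈x v∈y with x∈p∪q⁻ H (boundary H) (D.bags⊆A y v∈y)
      ... | inj₁ v∈H        = contradiction (bags⊆R∪⋃ x v∈x) (H∉R∪⋃ v∈H)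
      ... | inj₂ v∈boundary = subst (v ∈_) (sym root≡R) (boundary⊆R H v∈boundary) , D.W⊆root v∈boundary

      junction : SlickPair (bags T zero) (bags D.bag-tree zero)
      junction v v∈R v∈root
        with u , v-u , u∈root , u∉boundary ←
               D.root-anchors (closure∩R⊆boundary H⊆Rest (D.bags⊆A zero v∈root) (subst (v ∈_) root≡R v∈R))
        = u , v-u , u∈root , λ u∈R → H∉R∪⋃ u∈H (p⊆p∪q (⋃ Hs) (subst (u ∈_) root≡R u∈R))
        where
        u∈H : u ∈ H
        u∈H = closure─boundary⊆H H (x∈p∧x∉q⇒x∈p─q (D.bags⊆A zero u∈root) u∉boundary)

      into-glue : ∀ {v u} → (∃ λ y → v ∈ bags D.bag-tree y × u ∈ bags D.bag-tree y) →
        ∃ λ x → v ∈ bags glue x × u ∈ bags glue x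
      into-glue {v} {u} (y , v∈y , u∈y) =
        inr y , subst (v ∈_) (sym (bags-inr y)) v∈y , subst (u ∈_) (sym (bags-inr y)) u∈y

      covers-edges′ : ∀ {v} → v ∈ ⋃ (H ∷ Hs) → ∀ u → u ∈ A → Adj G v u →
        ∃ λ x → v ∈ bags glue x × u ∈ bags glue x
      covers-edges′ {v} v∈ u u∈A v-u with x∈p∪q⁻ H (⋃ Hs) v∈
      ... | inj₁ v∈H = into-glue (D.covers-edges v u v∈closure u∈closure v-u)
        where
        v∈closure = p⊆p∪q (boundary H) v∈H
        u∈closure = Interface.A-closed (child-interface adm) v∈closure (H∉R∪⋃ v∈H ∘ p⊆p∪q _ ∘ boundary⊆R H) v-u
      ... | inj₂ v∈⋃ with x , v∈x , u∈x ← covers-edges v∈⋃ u u∈A v-u =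
        inl x , subst (v ∈_) (sym (bags-inl x)) v∈x , subst (u ∈_) (sym (bags-inl x)) u∈x

      covers-vertices′ : ∀ {v} → v ∈ ⋃ (H ∷ Hs) → ∃ λ x → v ∈ bags glue x
      covers-vertices′ {v} v∈ with x∈p∪q⁻ H (⋃ Hs) v∈
      ... | inj₁ v∈H with y , v∈y ← D.covers-vertices v (p⊆p∪q (boundary H) v∈H) =
        inr y , subst (v ∈_) (sym (bags-inr y)) v∈y
      ... | inj₂ v∈⋃ with x , v∈x ← covers-vertices v∈⋃ = inl x , subst (v ∈_) (sym (bags-inl x)) v∈x

      attached : Assembled (H ∷ Hs) glue
      attached = record
        { root≡R          = trans (bags-inl zero) root≡R
        ; bags⊆R∪⋃        = glue-bags (_⊆ R ∪ ⋃ (H ∷ Hs))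
                              (λ x → ⊆-trans (bags⊆R∪⋃ x) (∪-monoʳ-⊆ R (q⊆p∪q H (⋃ Hs)))) bags⊆R∪⋃H∷Hs
        ; bags⊆A          = glue-bags (_⊆ A) bags⊆A (λ y → closure⊆A H⊆Rest ∘ D.bags⊆A y)
        ; coherent        = glue-coherent coherent D.coherent shared
        ; small           = glue-bags (λ B → ∣ B ∣ ≤ width) small D.small
        ; root-children   = trans glue-children-root (cong suc root-children)
        ; few-children    = glue-children-nonroot few-children D.few-children
        ; slick           = glue-edges SlickPair slick D.slick junction
        ; covers-edges    = covers-edges′
        ; covers-vertices = covers-vertices′
        }

    assemble : ∀ Hs → All Admissible Hs → AllPairs Separated Hs → Σ (BagTree n) (Assembled Hs)
    assemble []       []           []           = leaf R , root-assembled
    assemble (H ∷ Hs) (adm ∷ adms) (seps ∷ sep) with T , asm ← assemble Hs adms sep =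
      Glue.glue T _ , Attach.attached adm (Disjoint-⋃ (All.map proj₁ seps)) asm

    assembled : Σ (BagTree n) (Assembled groups)
    assembled = assemble groups groups-admissible groups-separated

    open Assembled (proj₂ assembled)

    assembled-tree : BagTree n
    assembled-tree = proj₁ assembled

    in-root : ∀ {v} → v ∈ R → v ∈ bags assembled-tree zero
    in-root {v} = subst (v ∈_) (sym root≡R)

    in-groups : ∀ {v} → v ∈ A → v ∉ R → v ∈ ⋃ groups
    in-groups v∈A v∉R = Rest⊆⋃groups (x∈p∧x∉q⇒x∈p─q v∈A v∉R)

    covers-edges-A : ∀ u v → u ∈ A → v ∈ A → Adj G u v →
      ∃ λ x → u ∈ bags assembled-tree x × v ∈ bags assembled-tree x
    covers-edges-A u v u∈A v∈A u-v with u ∈? R | v ∈? R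
    ... | yes u∈R | yes v∈R = zero , in-root u∈R , in-root v∈R
    ... | no  u∉R | _       = covers-edges (in-groups u∈A u∉R) v v∈A u-v
    ... | yes _   | no  v∉R with x , v∈x , u∈x ← covers-edges (in-groups v∈A v∉R) u u∈A (Adj-sym u-v) =
      x , u∈x , v∈x

    covers-vertices-A : ∀ v → v ∈ A → ∃ λ x → v ∈ bags assembled-tree x
    covers-vertices-A v v∈A with v ∈? R
    ... | yes v∈R = zero , in-root v∈R
    ... | no  v∉R = covers-vertices (in-groups v∈A v∉R)

    root-anchored : ∀ {w} → w ∈ W → ∃ λ u → Adj G w u × u ∈ bags assembled-tree zero × u ∉ W
    root-anchored w∈W with u , u∈N , w-u ← N-anchors w∈W =
      u , w-u , in-root (S⊆R (W∪N⊆S (q⊆p∪q W N u∈N))) , proj₂ (x∈p─q⁻ A W (N⊆A─W u∈N))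

    few-children-assembled : ∀ x → numChildren (shape assembled-tree) x ≤ branching
    few-children-assembled zero    = subst (_≤ branching) (sym root-children) few-groups
    few-children-assembled (suc x) = few-children x

    decomposition : Decomposition A W
    decomposition = record
      { bag-tree        = assembled-tree
      ; W⊆root          = in-root ∘ W⊆R
      ; bags⊆A          = bags⊆A
      ; covers-edges    = covers-edges-A
      ; covers-vertices = covers-vertices-A
      ; coherent        = coherent
      ; small           = small
      ; few-children    = few-children-assembled
      ; slick           = slick
      ; root-anchors    = root-anchored
      }

  decompose : ∀ f A W → ∣ A ─ W ∣ < f → Interface A W → Decomposition A W
  decompose (suc f) A W ∣A─W∣<1+f iface with ∣ A ∣ ≤? width
  ... | yes small = leaf-decomposition iface small
  ... | no  large = Split.decomposition A W iface large
                      (λ A′ W′ smaller → decompose f A′ W′ (<-≤-trans smaller (ℕ.s≤s⁻¹ ∣A─W∣<1+f)))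

  whole : Decomposition ⊤ ⊥
  whole = decompose _ ⊤ ⊥ (n<1+n _) record
    { W⊆A        = ⊆⊤
    ; ∣W∣≤t+ℓ     = ≤-trans (≤-reflexive (∣⊥∣≡0 n)) z≤n
    ; W-anchored = λ w∈⊥ → contradiction w∈⊥ ∉⊥
    ; A-closed   = λ _ _ _ → ∈⊤
    }

lemma18 : (ℓ t : ℕ) → 1 ≤ ℓ → .{{_ : NonZero t}} → ∀ {n} (G : Graph n) →
    (∀ (S : Subset n) → ∣ S ∣ ≡ 2 * t + 2 * ℓ →
      ∃ λ (X : Subset n) → ∣ X ∣ ≤ ℓ × ComponentsMeetAtMost G X S t) →
    ∃ λ (D : RootedTreeDecomposition G) →
      Slick D × WidthAtMost D (2 * t + 3 * ℓ ∸ 1) × DegreeAtMost D (4 + ⌈ 4 * ℓ / t ⌉)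
lemma18 ℓ t _ G separable = D , slick , width-bound , degree-bound
  where
  open Construction ℓ t G separable
  open Decomposition whole
  D : RootedTreeDecomposition G
  D = record
    { m                = size bag-tree
    ; tree             = shape bag-tree
    ; bag              = bags bag-tree
    ; edge-covered     = λ u v → covers-edges u v ∈⊤ ∈⊤
    ; vertex-nonempty  = λ v → covers-vertices v ∈⊤
    ; vertex-connected = coherent
    }
  width-bound : WidthAtMost D (2 * t + 3 * ℓ ∸ 1)
  width-bound x = ≤-trans (small x) (m≤n+m∸n width 1)
  degree-bound : DegreeAtMost D (4 + ⌈ 4 * ℓ / t ⌉)
  degree-bound zero    = m≤n⇒m≤1+n (few-children zero)
  degree-bound (suc x) = s≤s (few-children (suc x))
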